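{- Let $n$ be an even positive integer and let $r$ be a nonnegative integer with $r < n/2$. Then every $r$-regular simple graph $G$ on $n$ vertices can be extended to an $(r+1)$-regular graph on $n$ vertices, i.e., there is a set $F$ of edges of the complement $G^c$ such that the graph $(V(G), E(G)\cup F)$ is $(r+1)$-regular.
   Context: All graphs are finite and simple. A regular graph $G(n,r)$ is a graph on $n$ vertices in which every vertex has degree $r$. "Extending $G(n,r)$ to $G(n,r+1)$" means adding edges (not already present) to $G(n,r)$, keeping the same vertex set, so that the resulting graph is $(r+1)$-regular. -}

module Defs where

open import Data.Nat using (ℕ)
open import Data.Bool using (Bool; true; false; T)
open import Data.Fin using (Fin)
open import Data.List using (List; length; filterᵇ)
open import Data.List using (allFin) public
open import Data.Product using (_×_)
open import Relation.Binary.PropositionalEquality using (_≡_)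

record SimpleGraph (n : ℕ) : Set where
  field
    adj   : Fin n → Fin n → Bool
    sym   : ∀ u v → adj u v ≡ adj v u
    irrefl : ∀ v → adj v v ≡ false
open SimpleGraph public

degree : ∀ {n} → SimpleGraph n → Fin n → ℕ
degree G v = length (filterᵇ (adj G v) (allFin _))

IsRegular : ∀ {n} → SimpleGraph n → ℕ → Set
IsRegular G r = ∀ v → degree G v ≡ r

-- every edge of G is an edge of H (same vertex set); H = (V, E(G) ∪ F)
-- with F = E(H) \ E(G) ⊆ E(G^c)
IsSubgraph : ∀ {n} → SimpleGraph n → SimpleGraph n → Set
IsSubgraph G H = ∀ u v → T (adj G u v) → T (adj H u v)

-- The complement of an r-regular graph on n = 2h vertices with r < h has
-- minimum degree n - 1 - r ≥ h, hence a perfect matching, and adding that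
-- matching to G raises every degree by one. The perfect matching comes from
-- the augmenting-path argument behind Dirac's theorem, with matchings encoded
-- as involutions: since n is even, an unmatched vertex x is never the only
-- one, so take another, y. Either x ~ y, or the neighbourhood of x and the
-- preimage under the matching of the neighbourhood of y, both of size ≥ h
-- inside the n - 1 vertices other than x, share a vertex a; then matching
-- x - a (if a is unmatched), or replacing a - partner a by x - a and
-- partner a - y, leaves fewer vertices unmatched.
module Submission where

open import Defs hiding (sym)
open import Data.Bool using (Bool; true; false; T; not; _∨_)
open import Data.Bool.Properties using (T-∨)
open import Data.Empty using (⊥-elim)
open import Data.Fin using (Fin; zero; suc)
open import Data.Fin.Permutation using (permutation)
open import Data.Fin.Properties using (_≟_; _<?_; <-cmp; any?)
open import Data.List using (length; filterᵇ; tabulate)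
open import Data.Nat using (ℕ; zero; suc; _+_; _*_; _≤_; _<_; z≤n; s≤s)
open import Data.Nat.Induction using (<-wellFounded)
open import Data.Nat.Properties
  using ( +-0-commutativeMonoid; +-comm; +-identityʳ; +-mono-≤; +-monoʳ-≤; +-mono-≤-<; +-cancelʳ-≤
        ; ≤-refl; ≤-reflexive; ≤-trans; ≤-antisym; <-irrefl; <⇒≯; m<m+n; even≢odd; module ≤-Reasoning)
open import Algebra.Properties.CommutativeMonoid.Sum +-0-commutativeMonoid
  using (sum; sum-cong-≗; ∑-distrib-+; sum-permute)
open import Data.Sum using (_⊎_; inj₁; inj₂)
open import Data.Product using (Σ; ∃; _×_; _,_; proj₁; proj₂)
open import Data.Unit using (tt)
open import Function using (_∘_; id; mk⇔; Equivalence)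
open import Induction.WellFounded using (Acc; acc)
open import Relation.Binary.Definitions using (tri<; tri≈; tri>)
open import Relation.Binary.PropositionalEquality
open import Relation.Nullary using (¬_; Dec; yes; no; does)
open import Relation.Nullary.Decidable using (dec-true; dec-false; does-⇔; ¬?; _×-dec_; T?)

T-does : ∀ {A : Set} (a? : Dec A) → T (does a?) → A
T-does (yes a) _ = a

does-T : ∀ {A : Set} (a? : Dec A) → A → T (does a?)
does-T (yes _) _ = tt
does-T (no ¬a) a = ¬a a

indicator : Bool → ℕ
indicator true  = 1
indicator false = 0

count : ∀ {n} → (Fin n → Bool) → ℕ
count f = sum (indicator ∘ f)

length-filterᵇ-tabulate : ∀ {A : Set} {n} (f : A → Bool) (g : Fin n → A) →
  length (filterᵇ f (tabulate g)) ≡ count (f ∘ g)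
length-filterᵇ-tabulate {n = zero}  f g = refl
length-filterᵇ-tabulate {n = suc n} f g with f (g zero)
... | true  = cong suc (length-filterᵇ-tabulate f (g ∘ suc))
... | false = length-filterᵇ-tabulate f (g ∘ suc)

degree≡count : ∀ {n} (G : SimpleGraph n) v → degree G v ≡ count (adj G v)
degree≡count G v = length-filterᵇ-tabulate (adj G v) id

count-cong : ∀ {n} {f g : Fin n → Bool} → (∀ i → f i ≡ g i) → count f ≡ count g
count-cong f≗g = sum-cong-≗ (cong indicator ∘ f≗g)

count-+ : ∀ {n} (f g : Fin n → Bool) →
  count f + count g ≡ sum (λ i → indicator (f i) + indicator (g i))
count-+ f g = sym (∑-distrib-+ (indicator ∘ f) (indicator ∘ g))

count-true : ∀ n → count {n} (λ _ → true) ≡ n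
count-true zero    = refl
count-true (suc n) = cong suc (count-true n)

count-false : ∀ n → count {n} (λ _ → false) ≡ 0
count-false zero    = refl
count-false (suc n) = count-false n

count-≟ : ∀ {n} (x : Fin n) → count (λ a → does (x ≟ a)) ≡ 1
count-≟ {suc n} zero    = cong suc (count-false n)
count-≟ {suc n} (suc x) = count-≟ x

indicator-mono : ∀ {a b} → (T a → T b) → indicator a ≤ indicator b
indicator-mono {false}         _   = z≤n
indicator-mono {true}  {true}  _   = ≤-refl
indicator-mono {true}  {false} a⇒b = ⊥-elim (a⇒b tt)

count-mono : ∀ {n} {f g : Fin n → Bool} → (∀ i → T (f i) → T (g i)) → count f ≤ count g
count-mono {zero}  f⇒g = z≤n
count-mono {suc n} f⇒g = +-mono-≤ (indicator-mono (f⇒g zero)) (count-mono (f⇒g ∘ suc))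

count-mono-< : ∀ {n} {f g : Fin n → Bool} (x : Fin n) →
  (∀ i → T (f i) → T (g i)) → f x ≡ false → g x ≡ true → count f < count g
count-mono-< {suc n} zero f⇒g fx gx rewrite fx | gx = s≤s (count-mono (f⇒g ∘ suc))
count-mono-< {suc n} (suc x) f⇒g fx gx =
  +-mono-≤-< (indicator-mono (f⇒g zero)) (count-mono-< x (f⇒g ∘ suc) fx gx)

count-∨ : ∀ {n} {f g : Fin n → Bool} → (∀ i → T (f i) → g i ≡ false) →
  count (λ i → f i ∨ g i) ≡ count f + count g
count-∨ {f = f} {g} disjoint = trans (sum-cong-≗ pointwise) (sym (count-+ f g))
  where
  pointwise : ∀ i → indicator (f i ∨ g i) ≡ indicator (f i) + indicator (g i)
  pointwise i with f i | disjoint i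
  ... | true  | fi⇒¬gi rewrite fi⇒¬gi tt = refl
  ... | false | _ = refl

count-not : ∀ {n} (f : Fin n → Bool) → count (not ∘ f) + count f ≡ n
count-not {n} f = begin
  count (not ∘ f) + count f                     ≡⟨ count-+ (not ∘ f) f ⟩
  sum (λ i → indicator (not (f i)) + indicator (f i)) ≡⟨ sum-cong-≗ (one ∘ f) ⟩
  count {n} (λ _ → true)                        ≡⟨ count-true n ⟩
  n                                             ∎
  where
  open ≡-Reasoning
  one : ∀ b → indicator (not b) + indicator b ≡ 1
  one true  = refl
  one false = refl

count-∘-involution : ∀ {n} (p : Fin n → Fin n) → (∀ i → p (p i) ≡ i) →
  (f : Fin n → Bool) → count (f ∘ p) ≡ count f
count-∘-involution p inv f = sym (sum-permute (indicator ∘ f) (permutation p p inv inv))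

adj-≢ : ∀ {n} (G : SimpleGraph n) {u v} → T (adj G u v) → u ≢ v
adj-≢ G {u} uv refl = subst T (irrefl G u) uv

adj-sym : ∀ {n} (G : SimpleGraph n) {u v} → T (adj G u v) → T (adj G v u)
adj-sym G {u} {v} = subst T (SimpleGraph.sym G u v)

complement : ∀ {n} → SimpleGraph n → SimpleGraph n
complement G = record
  { adj    = λ u v → not (adj G u v ∨ does (u ≟ v))
  ; sym    = λ u v → cong₂ (λ a b → not (a ∨ b))
                       (SimpleGraph.sym G u v) (does-⇔ (mk⇔ sym sym) (u ≟ v) (v ≟ u))
  ; irrefl = λ v → cong₂ (λ a b → not (a ∨ b)) (irrefl G v) (dec-true (v ≟ v) refl)
  }

complement-excludes : ∀ {n} (G : SimpleGraph n) {u v} → T (adj (complement G) u v) → ¬ T (adj G u v)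
complement-excludes G {u} {v} cuv guv with adj G u v
... | true  = cuv
... | false = guv

degree-complement : ∀ {n} (G : SimpleGraph n) v → degree (complement G) v + suc (degree G v) ≡ n
degree-complement {n} G v = begin
  degree (complement G) v + suc (degree G v)   ≡⟨ cong₂ _+_ (degree≡count (complement G) v) closed-neighbourhood ⟩
  count (not ∘ neighbourOrSelf) + count neighbourOrSelf ≡⟨ count-not neighbourOrSelf ⟩
  n                                            ∎
  where
  open ≡-Reasoning
  neighbourOrSelf : Fin n → Bool
  neighbourOrSelf a = adj G v a ∨ does (v ≟ a)
  closed-neighbourhood : suc (degree G v) ≡ count neighbourOrSelf
  closed-neighbourhood = sym (begin
    count neighbourOrSelf                        ≡⟨ count-∨ (λ a va → dec-false (v ≟ a) (adj-≢ G va)) ⟩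
    count (adj G v) + count (λ a → does (v ≟ a)) ≡⟨ cong₂ _+_ (sym (degree≡count G v)) (count-≟ v) ⟩
    degree G v + 1                               ≡⟨ +-comm (degree G v) 1 ⟩
    suc (degree G v)                             ∎)

pairUp : ∀ {n} → (Fin n → Fin n) → Fin n → Fin n → Fin n → Fin n
pairUp f u v z with z ≟ u | z ≟ v
... | yes _ | _     = v
... | no _  | yes _ = u
... | no _  | no _  = f z

module _ {n} {f : Fin n → Fin n} {u v : Fin n} where

  pairUp-at-u : pairUp f u v u ≡ v
  pairUp-at-u with u ≟ u
  ... | yes _   = refl
  ... | no u≢u = ⊥-elim (u≢u refl)

  pairUp-at-v : u ≢ v → pairUp f u v v ≡ u
  pairUp-at-v u≢v with v ≟ u | v ≟ v
  ... | yes v≡u | _      = ⊥-elim (u≢v (sym v≡u))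
  ... | no _    | yes _  = refl
  ... | no _    | no v≢v = ⊥-elim (v≢v refl)

  pairUp-elsewhere : ∀ {z} → z ≢ u → z ≢ v → pairUp f u v z ≡ f z
  pairUp-elsewhere {z} z≢u z≢v with z ≟ u | z ≟ v
  ... | yes z≡u | _       = ⊥-elim (z≢u z≡u)
  ... | no _    | yes z≡v = ⊥-elim (z≢v z≡v)
  ... | no _    | no _    = refl

  pairUp-involutive : (∀ z → f (f z) ≡ z) → f u ≡ u → f v ≡ v → u ≢ v →
    ∀ z → pairUp f u v (pairUp f u v z) ≡ z
  pairUp-involutive inv fu fv u≢v z with z ≟ u | z ≟ v
  ... | yes refl | _        = pairUp-at-v u≢v
  ... | no _     | yes refl = pairUp-at-u
  ... | no z≢u   | no z≢v   = trans (pairUp-elsewhere (z≢u ∘ back fu) (z≢v ∘ back fv)) (inv z)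
    where
    back : ∀ {w} → f w ≡ w → f z ≡ w → z ≡ w
    back {w} fw fz≡w = trans (sym (inv z)) (trans (cong f fz≡w) fw)

isolate : ∀ {n} → (Fin n → Fin n) → Fin n → Fin n → Fin n
isolate f a z with z ≟ a | z ≟ f a
... | yes _ | _     = z
... | no _  | yes _ = z
... | no _  | no _  = f z

isolate-cases : ∀ {n} (f : Fin n → Fin n) a z →
  isolate f a z ≡ z ⊎ (z ≢ a × z ≢ f a × isolate f a z ≡ f z)
isolate-cases f a z with z ≟ a | z ≟ f a
... | yes _   | _       = inj₁ refl
... | no _    | yes _   = inj₁ refl
... | no z≢a  | no z≢fa = inj₂ (z≢a , z≢fa , refl)

isolate-elsewhere : ∀ {n} {f : Fin n → Fin n} {a z} → z ≢ a → z ≢ f a → isolate f a z ≡ f z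
isolate-elsewhere {f = f} {a} {z} z≢a z≢fa with z ≟ a | z ≟ f a
... | yes z≡a  | _        = ⊥-elim (z≢a z≡a)
... | no _     | yes z≡fa = ⊥-elim (z≢fa z≡fa)
... | no _     | no _     = refl

isolate-at : ∀ {n} {f : Fin n → Fin n} {a} → isolate f a a ≡ a
isolate-at {a = a} with a ≟ a
... | yes _   = refl
... | no a≢a = ⊥-elim (a≢a refl)

isolate-at-image : ∀ {n} {f : Fin n → Fin n} {a} → isolate f a (f a) ≡ f a
isolate-at-image {f = f} {a} with f a ≟ a | f a ≟ f a
... | yes _ | _         = refl
... | no _  | yes _     = refl
... | no _  | no fa≢fa = ⊥-elim (fa≢fa refl)

isolate-involutive : ∀ {n} {f : Fin n → Fin n} → (∀ z → f (f z) ≡ z) →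
  ∀ a z → isolate f a (isolate f a z) ≡ z
isolate-involutive {f = f} inv a z with isolate-cases f a z
... | inj₁ fixed = trans (cong (isolate f a) fixed) fixed
... | inj₂ (z≢a , z≢fa , moved) =
  trans (cong (isolate f a) moved) (trans (isolate-elsewhere fz≢a fz≢fa) (inv z))
  where
  fz≢a : f z ≢ a
  fz≢a fz≡a = z≢fa (trans (sym (inv z)) (cong f fz≡a))
  fz≢fa : f z ≢ f a
  fz≢fa fz≡fa = z≢a (trans (sym (inv z)) (trans (cong f fz≡fa) (inv a)))

module Matchings {n : ℕ} (G : SimpleGraph n) where

  record Matching : Set where
    field
      partner    : Fin n → Fin n
      involutive : ∀ v → partner (partner v) ≡ v
      adjacent   : ∀ v → partner v ≢ v → T (adj G v (partner v))
  open Matching public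

  Free : Matching → Fin n → Set
  Free m v = partner m v ≡ v

  IsPerfect : Matching → Set
  IsPerfect m = ∀ v → ¬ Free m v

  unmatched : Matching → ℕ
  unmatched m = count (λ v → does (partner m v ≟ v))

  empty : Matching
  empty = record { partner = id ; involutive = λ _ → refl ; adjacent = λ v v≢v → ⊥-elim (v≢v refl) }

  partner-flip : ∀ m {u v} → partner m u ≡ v → partner m v ≡ u
  partner-flip m {u} pu≡v = trans (cong (partner m) (sym pu≡v)) (involutive m u)

  free-partner : ∀ m {v} → Free m (partner m v) → Free m v
  free-partner m {v} fpv = sym (trans (sym (involutive m v)) fpv)

  unmatched-< : ∀ m m′ x → (∀ z → Free m′ z → Free m z) → Free m x → ¬ Free m′ x →
    unmatched m′ < unmatched m
  unmatched-< m m′ x free⇒free fx ¬f′x =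
    count-mono-< x (λ z → does-T (partner m z ≟ z) ∘ free⇒free z ∘ T-does (partner m′ z ≟ z))
      (dec-false (partner m′ x ≟ x) ¬f′x) (dec-true (partner m x ≟ x) fx)

  -- Each matched edge is counted once as v < partner v and once as partner v < v.
  unmatched-parity : ∀ m → unmatched m + 2 * count (λ v → does (partner m v <? v)) ≡ n
  unmatched-parity m = begin
    U + 2 * L                                     ≡⟨ cong (U +_) (cong (L +_) (+-identityʳ L)) ⟩
    U + (L + L)                                   ≡⟨ cong (λ R → U + (L + R)) (sym upward≡L) ⟩
    U + (L + count upward)                        ≡⟨ cong (U +_) (count-+ downward upward) ⟩
    U + sum (λ v → indicator (downward v) + indicator (upward v))
      ≡⟨ sym (∑-distrib-+ (indicator ∘ fixed) (λ v → indicator (downward v) + indicator (upward v))) ⟩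
    sum (λ v → indicator (fixed v) + (indicator (downward v) + indicator (upward v)))
      ≡⟨ sum-cong-≗ (λ v → trichotomy (partner m v) v) ⟩
    count {n} (λ _ → true)                        ≡⟨ count-true n ⟩
    n                                             ∎
    where
    open ≡-Reasoning
    fixed downward upward : Fin n → Bool
    fixed    v = does (partner m v ≟ v)
    downward v = does (partner m v <? v)
    upward   v = does (v <? partner m v)
    U L : ℕ
    U = unmatched m
    L = count downward
    upward≡L : count upward ≡ L
    upward≡L = trans (count-cong (λ v → cong (λ w → does (w <? partner m v)) (sym (involutive m v))))
                     (count-∘-involution (partner m) (involutive m) downward)
    trichotomy : ∀ i j →
      indicator (does (i ≟ j)) + (indicator (does (i <? j)) + indicator (does (j <? i))) ≡ 1
    trichotomy i j with <-cmp i j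
    ... | tri< i<j i≢j _
      rewrite dec-false (i ≟ j) i≢j | dec-true (i <? j) i<j | dec-false (j <? i) (<⇒≯ i<j) = refl
    ... | tri≈ i≮j i≡j j≮i
      rewrite dec-true (i ≟ j) i≡j | dec-false (i <? j) i≮j | dec-false (j <? i) j≮i = refl
    ... | tri> _ i≢j j<i
      rewrite dec-false (i ≟ j) i≢j | dec-false (i <? j) (<⇒≯ j<i) | dec-true (j <? i) j<i = refl

  another-free : ∀ {h} → n ≡ 2 * h → ∀ m {x} → Free m x → ∃ λ y → x ≢ y × Free m y
  another-free {h} n≡2h m {x} fx with any? (λ y → ¬? (x ≟ y) ×-dec (partner m y ≟ y))
  ... | yes found = found
  ... | no none   = ⊥-elim (even≢odd h S (begin
    2 * h                 ≡⟨ sym n≡2h ⟩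
    n                     ≡⟨ sym (unmatched-parity m) ⟩
    unmatched m + 2 * S   ≡⟨ cong (_+ 2 * S) (≤-antisym unmatched≤1 1≤unmatched) ⟩
    suc (2 * S)           ∎))
    where
    open ≡-Reasoning
    S : ℕ
    S = count (λ v → does (partner m v <? v))
    only-x-free : ∀ y → T (does (partner m y ≟ y)) → T (does (x ≟ y))
    only-x-free y fy with x ≟ y
    ... | yes _   = tt
    ... | no x≢y = none (y , x≢y , T-does (partner m y ≟ y) fy)
    unmatched≤1 : unmatched m ≤ 1
    unmatched≤1 = ≤-trans (count-mono only-x-free) (≤-reflexive (count-≟ x))
    1≤unmatched : 1 ≤ unmatched m
    1≤unmatched = ≤-trans (≤-reflexive (sym (count-≟ x)))
      (count-mono (λ y x≡y → does-T (partner m y ≟ y) (subst (Free m) (T-does (x ≟ y) x≡y) fx)))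

  module _ (m : Matching) {u v : Fin n} (fu : Free m u) (fv : Free m v) (uv : T (adj G u v)) where

    match : Matching
    match = record
      { partner    = pairUp (partner m) u v
      ; involutive = pairUp-involutive (involutive m) fu fv (adj-≢ G uv)
      ; adjacent   = adjacent′
      }
      where
      adjacent′ : ∀ z → pairUp (partner m) u v z ≢ z → T (adj G z (pairUp (partner m) u v z))
      adjacent′ z moved with z ≟ u | z ≟ v
      ... | yes refl | _        = uv
      ... | no _     | yes refl = adj-sym G uv
      ... | no _     | no _     = adjacent m z moved

    u-matched : ¬ Free match u
    u-matched fu′ = adj-≢ G uv (sym (trans (sym (pairUp-at-u {f = partner m} {u} {v})) fu′))

    v-matched : ¬ Free match v
    v-matched fv′ = adj-≢ G uv (trans (sym (pairUp-at-v {f = partner m} (adj-≢ G uv))) fv′)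

    match-free : ∀ {z} → Free match z → Free m z
    match-free {z} fz with z ≟ u | z ≟ v
    ... | yes z≡u | _       = ⊥-elim (adj-≢ G uv (trans (sym z≡u) (sym fz)))
    ... | no _    | yes z≡v = ⊥-elim (adj-≢ G uv (trans fz z≡v))
    ... | no _    | no _    = fz

    match-reduces : unmatched match < unmatched m
    match-reduces = unmatched-< m match u (λ _ → match-free) fu u-matched

  unmatch : Matching → Fin n → Matching
  unmatch m a = record
    { partner    = isolate (partner m) a
    ; involutive = isolate-involutive (involutive m) a
    ; adjacent   = adjacent′
    }
    where
    adjacent′ : ∀ z → isolate (partner m) a z ≢ z → T (adj G z (isolate (partner m) a z))
    adjacent′ z moved with isolate-cases (partner m) a z
    ... | inj₁ fixed = ⊥-elim (moved fixed)
    ... | inj₂ (_ , _ , moved′) rewrite moved′ = adjacent m z moved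

  unmatch-free : ∀ m a {z} → Free (unmatch m a) z → z ≢ a → z ≢ partner m a → Free m z
  unmatch-free m a fz z≢a z≢b = trans (sym (isolate-elsewhere {f = partner m} z≢a z≢b)) fz

  -- Rematching along the augmenting path x – a = partner a – y.
  augment : ∀ m {x y a} → Free m x → Free m y → x ≢ y → ¬ Free m a →
    T (adj G x a) → T (adj G y (partner m a)) → Σ Matching (λ m′ → unmatched m′ < unmatched m)
  augment m {x} {y} {a} fx fy x≢y ¬fa xa yb = m₃ , unmatched-< m m₃ x free₃⇒free fx ¬f₃x
    where
    b : Fin n
    b = partner m a
    ¬fb : ¬ Free m b
    ¬fb = ¬fa ∘ free-partner m
    x≢a : x ≢ a
    x≢a = adj-≢ G xa
    y≢b : y ≢ b
    y≢b = adj-≢ G yb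
    x≢b : x ≢ b
    x≢b x≡b = ¬fb (subst (Free m) x≡b fx)
    y≢a : y ≢ a
    y≢a y≡a = ¬fa (subst (Free m) y≡a fy)
    m₁ : Matching
    m₁ = unmatch m a
    f₁x : Free m₁ x
    f₁x = trans (isolate-elsewhere x≢a x≢b) fx
    f₁a : Free m₁ a
    f₁a = isolate-at {f = partner m}
    m₂ : Matching
    m₂ = match m₁ f₁x f₁a xa
    f₂y : Free m₂ y
    f₂y = trans (pairUp-elsewhere (x≢y ∘ sym) y≢a) (trans (isolate-elsewhere y≢a y≢b) fy)
    f₂b : Free m₂ b
    f₂b = trans (pairUp-elsewhere (x≢b ∘ sym) ¬fa) (isolate-at-image {f = partner m} {a})
    m₃ : Matching
    m₃ = match m₂ f₂y f₂b yb
    ¬f₃x : ¬ Free m₃ x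
    ¬f₃x = u-matched m₁ f₁x f₁a xa ∘ match-free m₂ f₂y f₂b yb
    free₃⇒free : ∀ z → Free m₃ z → Free m z
    free₃⇒free z fz = unmatch-free m a (match-free m₁ f₁x f₁a xa f₂z) z≢a z≢b
      where
      f₂z : Free m₂ z
      f₂z = match-free m₂ f₂y f₂b yb fz
      z≢a : z ≢ a
      z≢a z≡a = v-matched m₁ f₁x f₁a xa (subst (Free m₂) z≡a f₂z)
      z≢b : z ≢ b
      z≢b z≡b = v-matched m₂ f₂y f₂b yb (subst (Free m₃) z≡b fz)

module _ {h : ℕ} (G : SimpleGraph (2 * h)) (dense : ∀ v → h ≤ degree G v) where
  open Matchings G

  neighbour-of-partner : ∀ m {x y} → Free m x → ¬ T (adj G x y) →
    ∃ λ a → T (adj G x a) × T (adj G y (partner m a))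
  neighbour-of-partner m {x} {y} fx ¬xy
    with any? (λ a → T? (adj G x a) ×-dec T? (adj G y (partner m a)))
  ... | yes found = found
  ... | no none   = ⊥-elim (<-irrefl (cong (h +_) (sym (+-identityʳ h))) (begin-strict
    h + h                                           ≤⟨ +-mono-≤ (dense x) (dense y) ⟩
    degree G x + degree G y
      ≡⟨ cong₂ _+_ (degree≡count G x)
           (trans (degree≡count G y) (sym (count-∘-involution (partner m) (involutive m) (adj G y)))) ⟩
    count (adj G x) + count (adj G y ∘ partner m)   ≡⟨ sym (count-∨ disjoint) ⟩
    count (λ a → adj G x a ∨ adj G y (partner m a)) ≤⟨ count-mono outside ⟩
    count (λ a → not (does (x ≟ a)))               <⟨ m<m+n _ (≤-reflexive (sym (count-≟ x))) ⟩
    count (λ a → not (does (x ≟ a))) + count (λ a → does (x ≟ a)) ≡⟨ count-not (λ a → does (x ≟ a)) ⟩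
    2 * h                                           ∎))
    where
    open ≤-Reasoning
    disjoint : ∀ a → T (adj G x a) → adj G y (partner m a) ≡ false
    disjoint a xa with adj G y (partner m a) in yb
    ... | false = refl
    ... | true  = ⊥-elim (none (a , xa , subst T (sym yb) tt))
    outside : ∀ a → T (adj G x a ∨ adj G y (partner m a)) → T (not (does (x ≟ a)))
    outside a _ with x ≟ a
    outside a _ | no _ = tt
    outside x t | yes refl rewrite irrefl G x | fx = ¬xy (adj-sym G t)

  improve : ∀ m {x} → Free m x → Σ Matching (λ m′ → unmatched m′ < unmatched m)
  improve m {x} fx with another-free {h} refl m fx
  ... | y , x≢y , fy with T? (adj G x y)
  ...   | yes xy = match m fx fy xy , match-reduces m fx fy xy
  ...   | no ¬xy with neighbour-of-partner m fx ¬xy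
  ...     | a , xa , yb with partner m a ≟ a
  ...       | yes fa = match m fx fa xa , match-reduces m fx fa xa
  ...       | no ¬fa = augment m fx fy x≢y ¬fa xa yb

  perfectMatching : Σ Matching IsPerfect
  perfectMatching = perfect-from empty (<-wellFounded (unmatched empty))
    where
    perfect-from : ∀ m → Acc _<_ (unmatched m) → Σ Matching IsPerfect
    perfect-from m (acc smaller) with any? (λ v → partner m v ≟ v)
    ... | no none      = m , λ v fv → none (v , fv)
    ... | yes (x , fx) with improve m fx
    ...   | m′ , m′<m = perfect-from m′ (smaller m′<m)

module _ {n} (G : SimpleGraph n) (m : Matchings.Matching (complement G))
         (perfect : Matchings.IsPerfect (complement G) m) where
  open Matchings (complement G)

  addMatching : SimpleGraph n
  addMatching = record
    { adj    = λ u v → adj G u v ∨ does (partner m u ≟ v)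
    ; sym    = λ u v → cong₂ _∨_ (SimpleGraph.sym G u v)
                         (does-⇔ (mk⇔ (partner-flip m) (partner-flip m)) (partner m u ≟ v) (partner m v ≟ u))
    ; irrefl = λ v → cong₂ _∨_ (irrefl G v) (dec-false (partner m v ≟ v) (perfect v))
    }

  subgraph-addMatching : IsSubgraph G addMatching
  subgraph-addMatching u v uv = Equivalence.from T-∨ (inj₁ uv)

  degree-addMatching : ∀ v → degree addMatching v ≡ suc (degree G v)
  degree-addMatching v = begin
    degree addMatching v
      ≡⟨ degree≡count addMatching v ⟩
    count (λ a → adj G v a ∨ does (partner m v ≟ a))
      ≡⟨ count-∨ (λ a va → dec-false (partner m v ≟ a) (not-partner a va)) ⟩
    count (adj G v) + count (λ a → does (partner m v ≟ a))
      ≡⟨ cong₂ _+_ (sym (degree≡count G v)) (count-≟ (partner m v)) ⟩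
    degree G v + 1
      ≡⟨ +-comm (degree G v) 1 ⟩
    suc (degree G v) ∎
    where
    open ≡-Reasoning
    not-partner : ∀ a → T (adj G v a) → partner m v ≢ a
    not-partner a va refl = complement-excludes G (adjacent m v (perfect v)) va

mainTheorem1 : (k : ℕ) → (r : ℕ) → r < suc k →
    (G : SimpleGraph (2 * suc k)) → IsRegular G r →
    Σ (SimpleGraph (2 * suc k)) (λ H → IsSubgraph G H × IsRegular H (suc r))
mainTheorem1 k r r<k G regular =
  addMatching G m perfect , subgraph-addMatching G m perfect ,
  λ v → trans (degree-addMatching G m perfect v) (cong suc (regular v))
  where
  open Matchings (complement G)
  dense : ∀ v → suc k ≤ degree (complement G) v
  dense v = +-cancelʳ-≤ (suc r) (suc k) (degree (complement G) v) (begin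
    suc k + suc r                              ≤⟨ +-monoʳ-≤ (suc k) r<k ⟩
    suc k + suc k                              ≡⟨ cong (suc k +_) (sym (+-identityʳ (suc k))) ⟩
    2 * suc k                                  ≡⟨ sym (degree-complement G v) ⟩
    degree (complement G) v + suc (degree G v) ≡⟨ cong (λ d → degree (complement G) v + suc d) (regular v) ⟩
    degree (complement G) v + suc r            ∎)
    where open ≤-Reasoning
  m : Matching
  m = proj₁ (perfectMatching (complement G) dense)
  perfect : IsPerfect m
  perfect = proj₂ (perfectMatching (complement G) dense)
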